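{- For all $n\geq0$ and $m\geq1$, \[ \Omega_{n+1}(p,q;m)=\frac{p}{p-q}\left[\Omega_n(q,p;m)-\Omega_n(q,q;m)\right]. \]
   Context: For $n\ge1$, let $\mathcal{A}_n(m)$ be the set of maps $f:[n]\to\{1,\dots,m\}$ with $f(j)\le f(j+1)$ for odd $j\in[n-1]$ and $f(j)\ge f(j+1)$ for even $j\in[n-1]$. For $n\geq1$ define $\Omega_n(p,q;m)=\sum_{f\in\mathcal{A}_n(m)}p^{f(1)}q^{m+1-f(1)}$, and set $\Omega_0(p,q;m)=pq^m$. -}

module Defs where

open import Data.Nat as ℕ using (ℕ; zero; suc; _∸_; _≤ᵇ_)
open import Data.Bool using (Bool; true; false; _∧_)
open import Data.List using (List; []; _∷_; map; concatMap; filterᵇ; upTo; foldr)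
open import Data.Rational using (ℚ; 0ℚ; 1ℚ; _+_; _*_)

_^ℚ_ : ℚ → ℕ → ℚ
x ^ℚ zero  = 1ℚ
x ^ℚ suc k = x * (x ^ℚ k)

range1 : ℕ → List ℕ
range1 m = map suc (upTo m)

-- all maps f : [n] → {1,…,m}, represented as lists (f(1), …, f(n))
allMaps : ℕ → ℕ → List (List ℕ)
allMaps zero    m = [] ∷ []
allMaps (suc n) m = concatMap (λ a → map (a ∷_) (allMaps n m)) (range1 m)

-- alternating condition: f(j) ≤ f(j+1) for odd j, f(j) ≥ f(j+1) for even j.
-- altUp checks a suffix starting at an odd position, altDown at an even position.
altUp   : List ℕ → Bool
altDown : List ℕ → Bool
altUp   (a ∷ b ∷ rest) = (a ≤ᵇ b) ∧ altDown (b ∷ rest)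
altUp   _              = true
altDown (a ∷ b ∷ rest) = (b ≤ᵇ a) ∧ altUp (b ∷ rest)
altDown _              = true

𝒜 : ℕ → ℕ → List (List ℕ)
𝒜 n m = filterᵇ altUp (allMaps n m)

weight : ℚ → ℚ → ℕ → List ℕ → ℚ
weight p q m []      = 0ℚ   -- never used (n ≥ 1)
weight p q m (a ∷ _) = (p ^ℚ a) * (q ^ℚ (suc m ∸ a))

sumℚ : List ℚ → ℚ
sumℚ = foldr _+_ 0ℚ

Ω : ℕ → ℚ → ℚ → ℕ → ℚ
Ω zero    p q m = p * (q ^ℚ m)
Ω (suc n) p q m = sumℚ (map (weight p q m) (𝒜 (suc n) m))

-- Split 𝒜_{n+1}(m) by the first value a = f(1):  Ω_{n+1}(p,q) = Σ_a U_n(a) p^a q^{m+1-a},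
-- where U_k(a), D_k(a) count the words r ∈ [m]^k for which a ∷ r alternates starting
-- with an ascent, resp. a descent.  Then U_{k+1}(a) = Σ_{b ≥ a} D_k(b), and the
-- complement b ↦ m+1-b turns ascents into descents, so U_k(a) = D_k(m+1-a).
-- Exchanging the sums, (p-q) Ω_{k+2}(p,q) = Σ_b D_k(b) (p-q) Σ_{a ≤ b} p^a q^{m+1-a}, and
-- the inner sum telescopes to p (p^b q^{m+1-b} - q^{m+1}); substituting a = m+1-b this is
-- p [Ω_{k+1}(q,p) - Ω_{k+1}(q,q)].  For n = 0 the same telescoping sum, with U_0 = 1,
-- gives the claim directly.

module Submission where

open import Defs
open import Data.Nat using (ℕ; suc; _≥_)
open import Data.Rational using (ℚ; 0ℚ; _*_; _-_; _÷_; ≢-nonZero)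
open import Relation.Binary.PropositionalEquality using (_≡_; _≢_)

open import Data.Bool using (Bool; true; false; _∧_)
open import Data.Fin as Fin using (Fin; toℕ; opposite)
open import Data.Fin.Properties using (toℕ<n; opposite-prop; opposite-involutive)
import Data.Fin.Permutation as Permutation
open import Data.List using (List; []; _∷_; _++_; map; concatMap; filterᵇ; applyUpTo)
open import Data.List.Properties using (map-++; map-∘; map-cong)
open import Data.Nat as ℕ using (zero; _≤_; _≤ᵇ_; _<ᵇ_; _∸_; s≤s)
import Data.Nat.Properties as ℕ
open import Data.Rational using (1ℚ; _+_; 1/_; NonZero)
open import Data.Rational.Properties
open import Function using (_∘_; mk⇔)
open import Relation.Binary.PropositionalEquality using (refl; sym; trans; cong; cong₂; subst; module ≡-Reasoning)
open import Relation.Nullary.Decidable using (does-⇔; dec⇒maybe)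
open import Tactic.RingSolver using (solve-∀)
open import Tactic.RingSolver.Core.AlmostCommutativeRing using (AlmostCommutativeRing; fromCommutativeRing)

open import Algebra.Bundles using (CommutativeRing)
open import Algebra.Properties.Semiring.Sum (CommutativeRing.semiring +-*-commutativeRing)
  using (sum; sum-syntax; sum-cong-≗; ∑-comm; ∑-permute; *-distribˡ-sum)

ℚ-ring : AlmostCommutativeRing _ _
ℚ-ring = fromCommutativeRing +-*-commutativeRing (λ x → dec⇒maybe (0ℚ ≟ x))

𝟙 : Bool → ℚ
𝟙 true  = 1ℚ
𝟙 false = 0ℚ

𝟙-∧ : ∀ x y → 𝟙 (x ∧ y) ≡ 𝟙 x * 𝟙 y
𝟙-∧ true  y = sym (*-identityˡ (𝟙 y))
𝟙-∧ false y = sym (*-zeroˡ (𝟙 y))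

r*x≡p*y⇒x≡p÷r*y : ∀ r x p y .{{_ : NonZero r}} → r * x ≡ p * y → x ≡ (p ÷ r) * y
r*x≡p*y⇒x≡p÷r*y r x p y r*x≡p*y = begin
  x                  ≡⟨ *-identityˡ x ⟨
  1ℚ * x             ≡⟨ cong (_* x) (*-inverseˡ r) ⟨
  1/ r * r * x       ≡⟨ *-assoc (1/ r) r x ⟩
  1/ r * (r * x)     ≡⟨ cong (1/ r *_) r*x≡p*y ⟩
  1/ r * (p * y)     ≡⟨ rearrange (1/ r) p y ⟩
  p * 1/ r * y       ∎
  where
  open ≡-Reasoning
  rearrange : ∀ a b c → a * (b * c) ≡ b * a * c
  rearrange = solve-∀ ℚ-ring

sumℚ-++ : (xs ys : List ℚ) → sumℚ (xs ++ ys) ≡ sumℚ xs + sumℚ ys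
sumℚ-++ []       ys = sym (+-identityˡ (sumℚ ys))
sumℚ-++ (x ∷ xs) ys = trans (cong (x +_) (sumℚ-++ xs ys)) (sym (+-assoc x (sumℚ xs) (sumℚ ys)))

module _ {A : Set} where

  sumℚ-map-*ˡ : (c : ℚ) (f : A → ℚ) (xs : List A) →
                sumℚ (map (λ x → c * f x) xs) ≡ c * sumℚ (map f xs)
  sumℚ-map-*ˡ c f []       = sym (*-zeroʳ c)
  sumℚ-map-*ˡ c f (x ∷ xs) =
    trans (cong (c * f x +_) (sumℚ-map-*ˡ c f xs)) (sym (*-distribˡ-+ c (f x) (sumℚ (map f xs))))

  sumℚ-map-filterᵇ : (P : A → Bool) (f : A → ℚ) (xs : List A) →
                     sumℚ (map f (filterᵇ P xs)) ≡ sumℚ (map (λ x → f x * 𝟙 (P x)) xs)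
  sumℚ-map-filterᵇ P f []       = refl
  sumℚ-map-filterᵇ P f (x ∷ xs) with P x
  ... | true  = cong₂ _+_ (sym (*-identityʳ (f x))) (sumℚ-map-filterᵇ P f xs)
  ... | false = begin
    sumℚ (map f (filterᵇ P xs))               ≡⟨ sumℚ-map-filterᵇ P f xs ⟩
    sumℚ (map g xs)                           ≡⟨ +-identityˡ (sumℚ (map g xs)) ⟨
    0ℚ + sumℚ (map g xs)                      ≡⟨ cong (_+ sumℚ (map g xs)) (*-zeroʳ (f x)) ⟨
    f x * 0ℚ + sumℚ (map g xs)                ∎
    where
    open ≡-Reasoning
    g : A → ℚ
    g y = f y * 𝟙 (P y)

  sumℚ-map-𝟙-∧ : (b : Bool) (P : A → Bool) (xs : List A) →
                 sumℚ (map (λ x → 𝟙 (b ∧ P x)) xs) ≡ 𝟙 b * sumℚ (map (λ x → 𝟙 (P x)) xs)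
  sumℚ-map-𝟙-∧ b P xs =
    trans (cong sumℚ (map-cong (λ x → 𝟙-∧ b (P x)) xs)) (sumℚ-map-*ˡ (𝟙 b) (λ x → 𝟙 (P x)) xs)

  sumℚ-map-concatMap : {B : Set} (f : B → ℚ) (g : A → List B) (xs : List A) →
                       sumℚ (map f (concatMap g xs)) ≡ sumℚ (map (λ x → sumℚ (map f (g x))) xs)
  sumℚ-map-concatMap f g []       = refl
  sumℚ-map-concatMap f g (x ∷ xs) = begin
    sumℚ (map f (g x ++ concatMap g xs))               ≡⟨ cong sumℚ (map-++ f (g x) (concatMap g xs)) ⟩
    sumℚ (map f (g x) ++ map f (concatMap g xs))       ≡⟨ sumℚ-++ (map f (g x)) (map f (concatMap g xs)) ⟩
    sumℚ (map f (g x)) + sumℚ (map f (concatMap g xs)) ≡⟨ cong (sumℚ (map f (g x)) +_) (sumℚ-map-concatMap f g xs) ⟩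
    sumℚ (map f (g x)) + sumℚ (map (λ y → sumℚ (map f (g y))) xs) ∎
    where open ≡-Reasoning

sumℚ-map-applyUpTo : (f : ℕ → ℚ) (g : ℕ → ℕ) (n : ℕ) →
                     sumℚ (map f (applyUpTo g n)) ≡ ∑[ i < n ] f (g (toℕ i))
sumℚ-map-applyUpTo f g zero    = refl
sumℚ-map-applyUpTo f g (suc n) = cong (f (g 0) +_) (sumℚ-map-applyUpTo f (g ∘ suc) n)

sumℚ-map-range1 : (f : ℕ → ℚ) (m : ℕ) → sumℚ (map f (range1 m)) ≡ ∑[ i < m ] f (suc (toℕ i))
sumℚ-map-range1 f m = trans (cong sumℚ (sym (map-∘ (applyUpTo (λ i → i) m))))
                            (sumℚ-map-applyUpTo (f ∘ suc) (λ i → i) m)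

sumℚ-map-allMaps-suc : (f : List ℕ → ℚ) (n m : ℕ) →
  sumℚ (map f (allMaps (suc n) m)) ≡ ∑[ i < m ] sumℚ (map (λ r → f (suc (toℕ i) ∷ r)) (allMaps n m))
sumℚ-map-allMaps-suc f n m =
  trans (sumℚ-map-concatMap f (λ a → map (a ∷_) (allMaps n m)) (range1 m))
  (trans (sumℚ-map-range1 (λ a → sumℚ (map f (map (a ∷_) (allMaps n m)))) m)
         (sum-cong-≗ {m} (λ i → cong sumℚ (sym (map-∘ (allMaps n m))))))

∑-distrib-- : ∀ n (f g : Fin n → ℚ) → ∑[ i < n ] (f i - g i) ≡ ∑[ i < n ] f i - ∑[ i < n ] g i
∑-distrib-- zero    f g = refl
∑-distrib-- (suc n) f g =
  trans (cong (f Fin.zero - g Fin.zero +_) (∑-distrib-- n (f ∘ Fin.suc) (g ∘ Fin.suc)))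
        (regroup (f Fin.zero) (g Fin.zero) (sum {n} (f ∘ Fin.suc)) (sum {n} (g ∘ Fin.suc)))
  where
  regroup : ∀ a b c d → a - b + (c - d) ≡ a + c - (b + d)
  regroup = solve-∀ ℚ-ring

∑-truncate : ∀ {m b} (g : ℕ → ℚ) → b ≤ m → ∑[ i < m ] (𝟙 (toℕ i <ᵇ b) * g (toℕ i)) ≡ ∑[ i < b ] g (toℕ i)
∑-truncate {m} {zero} g _ = trans (sym (*-distribˡ-sum {m} 0ℚ (g ∘ toℕ))) (*-zeroˡ (sum {m} (g ∘ toℕ)))
∑-truncate {suc m} {suc b} g (s≤s b≤m) = cong₂ _+_ (*-identityˡ (g 0)) (∑-truncate (g ∘ suc) b≤m)

∑-telescope : ∀ b (F : ℕ → ℚ) → ∑[ i < b ] (F (suc (toℕ i)) - F (toℕ i)) ≡ F b - F 0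
∑-telescope zero    F = sym (+-inverseʳ (F 0))
∑-telescope (suc b) F =
  trans (cong (F 1 - F 0 +_) (∑-telescope b (F ∘ suc))) (cancel (F 0) (F 1) (F (suc b)))
  where
  cancel : ∀ x y z → y - x + (z - y) ≡ z - x
  cancel = solve-∀ ℚ-ring

suc-opposite-prop : ∀ {n} (i : Fin n) → suc (toℕ (opposite i)) ≡ n ∸ toℕ i
suc-opposite-prop i = trans (cong suc (opposite-prop i)) (sym (ℕ.+-∸-assoc 1 (toℕ<n i)))

i≤opposite[j]⇒j≤opposite[i] : ∀ {n} (i j : Fin n) → i Fin.≤ opposite j → j Fin.≤ opposite i
i≤opposite[j]⇒j≤opposite[i] {n} i j i≤opp[j] =
  subst (toℕ j ≤_) (sym (opposite-prop i)) (ℕ.m+n≤o⇒m≤o∸n (toℕ j) (subst (_≤ n) i+suc[j]≡j+suc[i] i+suc[j]≤n))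
  where
  i+suc[j]≤n : toℕ i ℕ.+ suc (toℕ j) ≤ n
  i+suc[j]≤n = ℕ.m≤o∸n⇒m+n≤o (toℕ i) (toℕ<n j) (subst (toℕ i ≤_) (opposite-prop j) i≤opp[j])
  i+suc[j]≡j+suc[i] : toℕ i ℕ.+ suc (toℕ j) ≡ toℕ j ℕ.+ suc (toℕ i)
  i+suc[j]≡j+suc[i] = trans (ℕ.+-suc (toℕ i) (toℕ j)) (trans (cong suc (ℕ.+-comm (toℕ i) (toℕ j))) (sym (ℕ.+-suc (toℕ j) (toℕ i))))

^ℚ-+ : ∀ x a b → x ^ℚ (a ℕ.+ b) ≡ x ^ℚ a * x ^ℚ b
^ℚ-+ x zero    b = sym (*-identityˡ (x ^ℚ b))
^ℚ-+ x (suc a) b = trans (cong (x *_) (^ℚ-+ x a b)) (sym (*-assoc x (x ^ℚ a) (x ^ℚ b)))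

monomial : ℚ → ℚ → ℕ → ℕ → ℚ
monomial p q m a = p ^ℚ a * q ^ℚ (suc m ∸ a)

monomial-step : ∀ p q {m a} → a ≤ m → q * monomial p q m (suc a) ≡ p * monomial p q m a
monomial-step p q {m} {a} a≤m = begin
  q * (p * p ^ℚ a * q ^ℚ (m ∸ a))        ≡⟨ rearrange q p (p ^ℚ a) (q ^ℚ (m ∸ a)) ⟩
  p * (p ^ℚ a * (q * q ^ℚ (m ∸ a)))      ≡⟨ cong (λ e → p * (p ^ℚ a * q ^ℚ e)) (ℕ.+-∸-assoc 1 a≤m) ⟨
  p * (p ^ℚ a * q ^ℚ (suc m ∸ a))        ∎
  where
  open ≡-Reasoning
  rearrange : ∀ q p P Q → q * (p * P * Q) ≡ p * (P * (q * Q))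
  rearrange = solve-∀ ℚ-ring

∑-monomial : ∀ p q {m b} → b ≤ m →
  (p - q) * ∑[ i < b ] monomial p q m (suc (toℕ i)) ≡ p * (monomial p q m b - monomial p q m 0)
∑-monomial p q {m} {b} b≤m = begin
  (p - q) * ∑[ i < b ] F (suc (toℕ i))                ≡⟨ *-distribˡ-sum {b} (p - q) (F ∘ suc ∘ toℕ) ⟩
  ∑[ i < b ] ((p - q) * F (suc (toℕ i)))              ≡⟨ sum-cong-≗ {b} (λ i → step (ℕ.<⇒≤ (ℕ.<-≤-trans (toℕ<n i) b≤m))) ⟩
  ∑[ i < b ] (p * (F (suc (toℕ i)) - F (toℕ i)))      ≡⟨ *-distribˡ-sum {b} p (λ i → F (suc (toℕ i)) - F (toℕ i)) ⟨
  p * ∑[ i < b ] (F (suc (toℕ i)) - F (toℕ i))        ≡⟨ cong (p *_) (∑-telescope b F) ⟩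
  p * (F b - F 0)                                     ∎
  where
  open ≡-Reasoning
  F : ℕ → ℚ
  F = monomial p q m
  step : ∀ {a} → a ≤ m → (p - q) * F (suc a) ≡ p * (F (suc a) - F a)
  step {a} a≤m = begin
    (p - q) * F (suc a)          ≡⟨ expand p q (F (suc a)) ⟩
    p * F (suc a) - q * F (suc a) ≡⟨ cong (p * F (suc a) -_) (monomial-step p q a≤m) ⟩
    p * F (suc a) - p * F a      ≡⟨ factor p (F (suc a)) (F a) ⟩
    p * (F (suc a) - F a)        ∎
    where
    expand : ∀ p q x → (p - q) * x ≡ p * x - q * x
    expand = solve-∀ ℚ-ring
    factor : ∀ p x y → p * x - p * y ≡ p * (x - y)
    factor = solve-∀ ℚ-ring

monomial-opposite : ∀ p q {m} (i : Fin m) → monomial q p m (suc (toℕ (opposite i))) ≡ monomial p q m (suc (toℕ i))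
monomial-opposite p q {m} i = begin
  q ^ℚ suc (toℕ i′) * p ^ℚ (m ∸ toℕ i′)  ≡⟨ *-comm (q ^ℚ suc (toℕ i′)) (p ^ℚ (m ∸ toℕ i′)) ⟩
  p ^ℚ (m ∸ toℕ i′) * q ^ℚ suc (toℕ i′)  ≡⟨ cong₂ (λ a b → p ^ℚ a * q ^ℚ b) m-i′≡i+1 (suc-opposite-prop i) ⟩
  p ^ℚ suc (toℕ i) * q ^ℚ (m ∸ toℕ i)    ∎
  where
  open ≡-Reasoning
  i′ : Fin m
  i′ = opposite i
  m-i′≡i+1 : m ∸ toℕ i′ ≡ suc (toℕ i)
  m-i′≡i+1 = trans (sym (suc-opposite-prop i′)) (cong (suc ∘ toℕ) (opposite-involutive i))

monomial-diagonal : ∀ q {m a} → a ≤ suc m → monomial q q m a ≡ q ^ℚ suc m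
monomial-diagonal q {m} {a} a≤m+1 = trans (sym (^ℚ-+ q a (suc m ∸ a))) (cong (q ^ℚ_) (ℕ.m+[n∸m]≡n a≤m+1))

upCount downCount : ℕ → ℕ → ℕ → ℚ
upCount   m k a = sumℚ (map (λ r → 𝟙 (altUp   (a ∷ r))) (allMaps k m))
downCount m k a = sumℚ (map (λ r → 𝟙 (altDown (a ∷ r))) (allMaps k m))

upCount-zero : ∀ m a → upCount m 0 a ≡ 1ℚ
upCount-zero m a = +-identityʳ 1ℚ

upCount-suc : ∀ m k a →
  upCount m (suc k) a ≡ ∑[ j < m ] (𝟙 (a ≤ᵇ suc (toℕ j)) * downCount m k (suc (toℕ j)))
upCount-suc m k a = trans (sumℚ-map-allMaps-suc (λ r → 𝟙 (altUp (a ∷ r))) k m)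
  (sum-cong-≗ {m} (λ j → sumℚ-map-𝟙-∧ (a ≤ᵇ suc (toℕ j)) (λ r → altDown (suc (toℕ j) ∷ r)) (allMaps k m)))

downCount-suc : ∀ m k a →
  downCount m (suc k) a ≡ ∑[ j < m ] (𝟙 (suc (toℕ j) ≤ᵇ a) * upCount m k (suc (toℕ j)))
downCount-suc m k a = trans (sumℚ-map-allMaps-suc (λ r → 𝟙 (altDown (a ∷ r))) k m)
  (sum-cong-≗ {m} (λ j → sumℚ-map-𝟙-∧ (suc (toℕ j) ≤ᵇ a) (λ r → altUp (suc (toℕ j) ∷ r)) (allMaps k m)))

≤ᵇ-opposite : ∀ {m} (i j : Fin m) →
  (suc (toℕ i) ≤ᵇ suc (toℕ (opposite j))) ≡ (suc (toℕ j) ≤ᵇ suc (toℕ (opposite i)))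
-- does (x ℕ.≤? y) is x ≤ᵇ y by definition.
≤ᵇ-opposite i j = does-⇔ (mk⇔ (reverse i j) (reverse j i)) (_ ℕ.≤? _) (_ ℕ.≤? _)
  where
  reverse : ∀ {m} (i j : Fin m) → suc (toℕ i) ≤ suc (toℕ (opposite j)) → suc (toℕ j) ≤ suc (toℕ (opposite i))
  reverse i j = s≤s ∘ i≤opposite[j]⇒j≤opposite[i] i j ∘ ℕ.s≤s⁻¹

upCount-opposite : ∀ m k (i : Fin m) → upCount m k (suc (toℕ i)) ≡ downCount m k (suc (toℕ (opposite i)))
upCount-opposite m zero    i = refl
upCount-opposite m (suc k) i = begin
  upCount m (suc k) (suc (toℕ i))
    ≡⟨ upCount-suc m k _ ⟩
  ∑[ j < m ] (𝟙 (suc (toℕ i) ≤ᵇ suc (toℕ j)) * downCount m k (suc (toℕ j)))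
    ≡⟨ ∑-permute {m} _ Permutation.reverse ⟩
  ∑[ j < m ] (𝟙 (suc (toℕ i) ≤ᵇ suc (toℕ (opposite j))) * downCount m k (suc (toℕ (opposite j))))
    ≡⟨ sum-cong-≗ {m} (λ j → cong₂ _*_ (cong 𝟙 (≤ᵇ-opposite i j)) (sym (upCount-opposite m k j))) ⟩
  ∑[ j < m ] (𝟙 (suc (toℕ j) ≤ᵇ suc (toℕ (opposite i))) * upCount m k (suc (toℕ j)))
    ≡⟨ downCount-suc m k _ ⟨
  downCount m (suc k) (suc (toℕ (opposite i))) ∎
  where open ≡-Reasoning

Ω-suc : ∀ n p q m → Ω (suc n) p q m ≡ ∑[ i < m ] (monomial p q m (suc (toℕ i)) * upCount m n (suc (toℕ i)))
Ω-suc n p q m =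
  trans (sumℚ-map-filterᵇ altUp (weight p q m) (allMaps (suc n) m))
  (trans (sumℚ-map-allMaps-suc (λ f → weight p q m f * 𝟙 (altUp f)) n m)
         (sum-cong-≗ {m} (λ i → sumℚ-map-*ˡ (monomial p q m (suc (toℕ i))) (λ r → 𝟙 (altUp (suc (toℕ i) ∷ r))) (allMaps n m))))

Ω-suc-suc : ∀ k p q m → Ω (suc (suc k)) p q m ≡
  ∑[ j < m ] (downCount m k (suc (toℕ j)) * ∑[ i < suc (toℕ j) ] monomial p q m (suc (toℕ i)))
Ω-suc-suc k p q m = begin
  Ω (suc (suc k)) p q m
    ≡⟨ Ω-suc (suc k) p q m ⟩
  ∑[ i < m ] (M i * upCount m (suc k) (suc (toℕ i)))
    ≡⟨ sum-cong-≗ {m} (λ i → trans (cong (M i *_) (upCount-suc m k _)) (*-distribˡ-sum {m} (M i) _)) ⟩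
  -- suc a ≤ᵇ suc b unfolds to a <ᵇ suc b, the form ∑-truncate expects
  ∑[ i < m ] ∑[ j < m ] (M i * (𝟙 (toℕ i <ᵇ suc (toℕ j)) * D j))
    ≡⟨ ∑-comm {m} {m} _ ⟩
  ∑[ j < m ] ∑[ i < m ] (M i * (𝟙 (toℕ i <ᵇ suc (toℕ j)) * D j))
    ≡⟨ sum-cong-≗ {m} (λ j → trans (sum-cong-≗ {m} (λ i → rearrange (M i) (𝟙 (toℕ i <ᵇ suc (toℕ j))) (D j)))
                                   (sym (*-distribˡ-sum {m} (D j) _))) ⟩
  ∑[ j < m ] (D j * ∑[ i < m ] (𝟙 (toℕ i <ᵇ suc (toℕ j)) * M i))
    ≡⟨ sum-cong-≗ {m} (λ j → cong (D j *_) (∑-truncate (monomial p q m ∘ suc) (toℕ<n j))) ⟩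
  ∑[ j < m ] (D j * ∑[ i < suc (toℕ j) ] M i) ∎
  where
  open ≡-Reasoning
  M : ∀ {n} → Fin n → ℚ
  M i = monomial p q m (suc (toℕ i))
  D : Fin m → ℚ
  D j = downCount m k (suc (toℕ j))
  rearrange : ∀ x y z → x * (y * z) ≡ z * (y * x)
  rearrange = solve-∀ ℚ-ring

Ω-difference : ∀ k p q m → Ω (suc k) q p m - Ω (suc k) q q m ≡
  ∑[ j < m ] (downCount m k (suc (toℕ j)) * (monomial p q m (suc (toℕ j)) - monomial p q m 0))
Ω-difference k p q m = begin
  Ω (suc k) q p m - Ω (suc k) q q m
    ≡⟨ cong₂ _-_ (Ω-suc k q p m) (Ω-suc k q q m) ⟩
  ∑[ i < m ] (monomial q p m (val i) * U i) - ∑[ i < m ] (monomial q q m (val i) * U i)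
    ≡⟨ ∑-distrib-- m _ _ ⟨
  ∑[ i < m ] (monomial q p m (val i) * U i - monomial q q m (val i) * U i)
    ≡⟨ ∑-permute {m} _ Permutation.reverse ⟩
  ∑[ j < m ] (monomial q p m (val (opposite j)) * U (opposite j) - monomial q q m (val (opposite j)) * U (opposite j))
    ≡⟨ sum-cong-≗ {m} reflected ⟩
  ∑[ j < m ] (downCount m k (val j) * (monomial p q m (val j) - monomial p q m 0)) ∎
  where
  open ≡-Reasoning
  val : Fin m → ℕ
  val i = suc (toℕ i)
  U D : Fin m → ℚ
  U i = upCount m k (val i)
  D j = downCount m k (val j)
  factor : ∀ a b d → a * d - b * d ≡ d * (a - b)
  factor = solve-∀ ℚ-ring
  reflected : ∀ j → monomial q p m (val (opposite j)) * U (opposite j) - monomial q q m (val (opposite j)) * U (opposite j)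
                  ≡ D j * (monomial p q m (val j) - monomial p q m 0)
  reflected j = begin
    monomial q p m (val j′) * U j′ - monomial q q m (val j′) * U j′
      ≡⟨ cong (λ d → monomial q p m (val j′) * d - monomial q q m (val j′) * d) U[j′]≡D[j] ⟩
    monomial q p m (val j′) * D j - monomial q q m (val j′) * D j
      ≡⟨ cong₂ (λ a b → a * D j - b * D j) (monomial-opposite p q j) qq[j′]≡pq[0] ⟩
    monomial p q m (val j) * D j - monomial p q m 0 * D j
      ≡⟨ factor (monomial p q m (val j)) (monomial p q m 0) (D j) ⟩
    D j * (monomial p q m (val j) - monomial p q m 0) ∎
    where
    j′ : Fin m
    j′ = opposite j
    U[j′]≡D[j] : U j′ ≡ D j
    U[j′]≡D[j] = trans (upCount-opposite m k j′) (cong D (opposite-involutive j))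
    qq[j′]≡pq[0] : monomial q q m (val j′) ≡ monomial p q m 0
    qq[j′]≡pq[0] = trans (monomial-diagonal q (s≤s (ℕ.<⇒≤ (toℕ<n j′)))) (sym (*-identityˡ (q ^ℚ suc m)))

Ω-recurrence : ∀ n m p q → (p - q) * Ω (suc n) p q m ≡ p * (Ω n q p m - Ω n q q m)
Ω-recurrence zero m p q = begin
  (p - q) * Ω 1 p q m
    ≡⟨ cong ((p - q) *_) (trans (Ω-suc 0 p q m) (sum-cong-≗ {m} (λ i → trans (cong (M i *_) (upCount-zero m (suc (toℕ i)))) (*-identityʳ (M i))))) ⟩
  (p - q) * ∑[ i < m ] M i
    ≡⟨ ∑-monomial p q (ℕ.≤-refl {m}) ⟩
  p * (p ^ℚ m * q ^ℚ (suc m ∸ m) - 1ℚ * q ^ℚ suc m)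
    ≡⟨ cong (λ e → p * (p ^ℚ m * q ^ℚ e - 1ℚ * q ^ℚ suc m)) (ℕ.m+n∸n≡m 1 m) ⟩
  p * (p ^ℚ m * (q * 1ℚ) - 1ℚ * (q * q ^ℚ m))
    ≡⟨ normalise p q (p ^ℚ m) (q ^ℚ m) ⟩
  p * (q * p ^ℚ m - q * q ^ℚ m) ∎
  where
  open ≡-Reasoning
  M : Fin m → ℚ
  M i = monomial p q m (suc (toℕ i))
  normalise : ∀ p q P Q → p * (P * (q * 1ℚ) - 1ℚ * (q * Q)) ≡ p * (q * P - q * Q)
  normalise = solve-∀ ℚ-ring
Ω-recurrence (suc k) m p q = begin
  (p - q) * Ω (suc (suc k)) p q m
    ≡⟨ cong ((p - q) *_) (Ω-suc-suc k p q m) ⟩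
  (p - q) * ∑[ j < m ] (D j * S j)
    ≡⟨ *-distribˡ-sum {m} (p - q) _ ⟩
  ∑[ j < m ] ((p - q) * (D j * S j))
    ≡⟨ sum-cong-≗ {m} (λ j → trans (rearrange (p - q) (D j) (S j)) (cong (D j *_) (∑-monomial p q (toℕ<n j)))) ⟩
  ∑[ j < m ] (D j * (p * X j))
    ≡⟨ sum-cong-≗ {m} (λ j → rearrange p (D j) (X j)) ⟨
  ∑[ j < m ] (p * (D j * X j))
    ≡⟨ *-distribˡ-sum {m} p _ ⟨
  p * ∑[ j < m ] (D j * X j)
    ≡⟨ cong (p *_) (Ω-difference k p q m) ⟨
  p * (Ω (suc k) q p m - Ω (suc k) q q m) ∎
  where
  open ≡-Reasoning
  D S X : Fin m → ℚ
  D j = downCount m k (suc (toℕ j))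
  S j = ∑[ i < suc (toℕ j) ] monomial p q m (suc (toℕ i))
  X j = monomial p q m (suc (toℕ j)) - monomial p q m 0
  rearrange : ∀ x y z → x * (y * z) ≡ y * (x * z)
  rearrange = solve-∀ ℚ-ring

proposition4p1 : (n m : ℕ) → m ≥ 1 → (p q : ℚ) → (p≢q : p - q ≢ 0ℚ) →
    Ω (suc n) p q m ≡ (_÷_ p (p - q) {{≢-nonZero p≢q}}) * (Ω n q p m - Ω n q q m)
proposition4p1 n m _ p q p≢q =
  r*x≡p*y⇒x≡p÷r*y (p - q) (Ω (suc n) p q m) p (Ω n q p m - Ω n q q m) {{≢-nonZero p≢q}} (Ω-recurrence n m p q)
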